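{- For all positive integers $n$ and $r$, $$\sum_{k=0}^{n-1}(2k+1)^{2r-1}\equiv 0\pmod n.$$ -}

module Defs where

open import Data.Nat using (ℕ; _+_; _*_; _^_; _∸_)
open import Data.List using (map; upTo)
open import Data.Nat.ListAction using (sum)

oddPowerSum : ℕ → ℕ → ℕ
oddPowerSum n r = sum (map (λ k → (2 * k + 1) ^ (2 * r ∸ 1)) (upTo n))

-- Pair the term for k with the term for n − 1 − k.  Their bases 2k + 1 and
-- 2(n − 1 − k) + 1 add up to 2n, and a + b divides a^m + b^m for odd m, so
-- 2n divides every pair and hence twice the sum; cancelling 2 gives n ∣ sum.
module Submission where

open import Defs
open import Data.Nat using (ℕ; zero; suc; _<_; _+_; _*_; _^_; _∸_)
open import Data.Nat.Properties using (*-suc; *-identityʳ; +-identityʳ; m+[n∸m]≡n)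
open import Data.Nat.Divisibility
  using (_∣_; _∣0; ∣-refl; ∣-trans; ∣m∣n⇒∣m+n; ∣m+n∣m⇒∣n; *-cancelˡ-∣; m∣m*n; n∣m*n)
open import Data.Nat.ListAction using (sum)
open import Data.Nat.ListAction.Properties using (sum-↭)
open import Data.Nat.Tactic.RingSolver using (solve-∀)
open import Data.List using (List; _∷_; applyUpTo; applyDownFrom; reverse)
open import Data.List.Properties using (map-upTo; reverse-applyUpTo)
open import Data.List.Relation.Unary.All using (All; []; _∷_)
open import Data.List.Relation.Unary.All.Properties using (applyUpTo⁺₁)
open import Data.List.Relation.Binary.Permutation.Propositional.Properties using (↭-reverse)
open import Function using (_∘_)
open import Relation.Binary.PropositionalEquality
  using (_≡_; refl; sym; cong; cong₂; subst; module ≡-Reasoning)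

private
  variable
    A : Set
    d : ℕ

∣-sum : {ns : List ℕ} → All (d ∣_) ns → d ∣ sum ns
∣-sum {d} []         = d ∣0
∣-sum     (d∣n ∷ ds) = ∣m∣n⇒∣m+n d∣n (∣-sum ds)

sum-applyUpTo-+ : ∀ (f g : ℕ → ℕ) n →
                  sum (applyUpTo (λ k → f k + g k) n) ≡ sum (applyUpTo f n) + sum (applyUpTo g n)
sum-applyUpTo-+ f g zero    = refl
sum-applyUpTo-+ f g (suc n) = begin
  f 0 + g 0 + sum (applyUpTo (λ k → f (suc k) + g (suc k)) n)
    ≡⟨ cong (f 0 + g 0 +_) (sum-applyUpTo-+ (f ∘ suc) (g ∘ suc) n) ⟩
  f 0 + g 0 + (F + G)
    ≡⟨ interchange (f 0) (g 0) F G ⟩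
  f 0 + F + (g 0 + G) ∎
  where
  open ≡-Reasoning
  F G : ℕ
  F = sum (applyUpTo (f ∘ suc) n)
  G = sum (applyUpTo (g ∘ suc) n)
  interchange : ∀ a b c e → a + b + (c + e) ≡ a + c + (b + e)
  interchange = solve-∀

applyUpTo-reflect : ∀ (f : ℕ → A) n → applyUpTo (λ k → f (n ∸ suc k)) n ≡ applyDownFrom f n
applyUpTo-reflect f zero    = refl
applyUpTo-reflect f (suc n) = cong (f n ∷_) (applyUpTo-reflect f n)

sum-applyUpTo-reflect : ∀ (f : ℕ → ℕ) n → sum (applyUpTo f n) ≡ sum (applyUpTo (λ k → f (n ∸ suc k)) n)
sum-applyUpTo-reflect f n = begin
  sum (applyUpTo f n)                        ≡⟨ sum-↭ (↭-reverse (applyUpTo f n)) ⟨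
  sum (reverse (applyUpTo f n))              ≡⟨ cong sum (reverse-applyUpTo f n) ⟩
  sum (applyDownFrom f n)                    ≡⟨ cong sum (applyUpTo-reflect f n) ⟨
  sum (applyUpTo (λ k → f (n ∸ suc k)) n)    ∎
  where open ≡-Reasoning

∣-2*sum-applyUpTo : ∀ (f : ℕ → ℕ) n → (∀ {k} → k < n → d ∣ f k + f (n ∸ suc k)) →
                    d ∣ 2 * sum (applyUpTo f n)
∣-2*sum-applyUpTo {d} f n pairs = subst (d ∣_) 2*sum≡pairSum (∣-sum (applyUpTo⁺₁ pair n pairs))
  where
  open ≡-Reasoning
  pair : ℕ → ℕ
  pair k = f k + f (n ∸ suc k)
  S : ℕ
  S = sum (applyUpTo f n)
  2*sum≡pairSum : sum (applyUpTo pair n) ≡ 2 * S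
  2*sum≡pairSum = begin
    sum (applyUpTo pair n)                               ≡⟨ sum-applyUpTo-+ f (λ k → f (n ∸ suc k)) n ⟩
    S + sum (applyUpTo (λ k → f (n ∸ suc k)) n)          ≡⟨ cong (S +_) (sum-applyUpTo-reflect f n) ⟨
    S + S                                                ≡⟨ cong (S +_) (+-identityʳ S) ⟨
    2 * S                                                ∎

+∣^+^⇒+∣^2+^2 : ∀ a b m → a + b ∣ a ^ m + b ^ m → a + b ∣ a ^ (2 + m) + b ^ (2 + m)
+∣^+^⇒+∣^2+^2 a b m a+b∣ = ∣m+n∣m⇒∣n
  (subst (a + b ∣_) (identity a b (a ^ m) (b ^ m)) (m∣m*n _))
  (∣-trans a+b∣ (n∣m*n (a * b)))
  where
  -- a^(2+m) + b^(2+m) = (a + b)(a^(1+m) + b^(1+m)) − ab(a^m + b^m), arranged without subtraction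
  identity : ∀ a b A B → (a + b) * (a * A + b * B) ≡ a * b * (A + B) + (a * (a * A) + b * (b * B))
  identity = solve-∀

+∣^+^-odd : ∀ a b j → a + b ∣ a ^ suc (2 * j) + b ^ suc (2 * j)
+∣^+^-odd a b zero    = subst (a + b ∣_) (sym (cong₂ _+_ (*-identityʳ a) (*-identityʳ b))) ∣-refl
+∣^+^-odd a b (suc j) = subst (λ m → a + b ∣ a ^ suc m + b ^ suc m) (sym (*-suc 2 j))
  (+∣^+^⇒+∣^2+^2 a b (suc (2 * j)) (+∣^+^-odd a b j))

odd-reflect-sum : ∀ {n k} → k < n → (2 * k + 1) + (2 * (n ∸ suc k) + 1) ≡ 2 * n
odd-reflect-sum {n} {k} k<n = begin
  (2 * k + 1) + (2 * (n ∸ suc k) + 1) ≡⟨ regroup k (n ∸ suc k) ⟩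
  2 * (suc k + (n ∸ suc k))           ≡⟨ cong (2 *_) (m+[n∸m]≡n k<n) ⟩
  2 * n                               ∎
  where
  open ≡-Reasoning
  regroup : ∀ k x → 2 * k + 1 + (2 * x + 1) ≡ 2 * (suc k + x)
  regroup = solve-∀

2n∣odd-power-reflect-sum : ∀ {n k} j → k < n →
                          2 * n ∣ (2 * k + 1) ^ suc (2 * j) + (2 * (n ∸ suc k) + 1) ^ suc (2 * j)
2n∣odd-power-reflect-sum {n} {k} j k<n =
  subst (_∣ a ^ suc (2 * j) + b ^ suc (2 * j)) (odd-reflect-sum k<n) (+∣^+^-odd a b j)
  where
  a b : ℕ
  a = 2 * k + 1
  b = 2 * (n ∸ suc k) + 1

lemma2p1 : (n r : ℕ) → 0 < n → 0 < r → n ∣ oddPowerSum n r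
lemma2p1 n (suc j) _ _ = *-cancelˡ-∣ 2 (subst (λ s → 2 * n ∣ 2 * s) (sym (cong sum (map-upTo f n)))
  (∣-2*sum-applyUpTo f n (λ {k} k<n → subst (2n∣pair k) (sym exponent) (2n∣odd-power-reflect-sum j k<n))))
  where
  f : ℕ → ℕ
  f k = (2 * k + 1) ^ (2 * suc j ∸ 1)
  2n∣pair : ℕ → ℕ → Set
  2n∣pair k m = 2 * n ∣ (2 * k + 1) ^ m + (2 * (n ∸ suc k) + 1) ^ m
  exponent : 2 * suc j ∸ 1 ≡ suc (2 * j)
  exponent = cong (_∸ 1) (*-suc 2 j)
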